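{- For all $m,n\in\mathbb{P}$, $$F_{0^m}\cdot F_{0^n}=\sum_{j=0}^m(-1)^j\binom{m}{j}\binom{m+n-j}{m}F_{0^{m+n-j}}.$$
   Context: $\mathbb{N}=\{0,1,2,\dots\}$, $\mathbb{P}=\{1,2,\dots\}$. $\mathbb{Z}[[x_1,x_2,\dots]]_{\mathbb{N}}$: formal power series whose monomials are finite products $\prod_{i\in I}x_i^{a_i}$ ($a_i\in\mathbb{N}$), where $x_i^0$ is a formal symbol distinct from $1$ and $x_i^ax_i^b=x_i^{a+b}$ (so $x_i^0x_i^0=x_i^0$). For $r\in\mathbb{P}$, $F_{0^r}=\sum_{1\le i_1\le i_2\le\dots\le i_r}x_{i_1}^0x_{i_2}^0\cdots x_{i_r}^0$ (equivalently $\sum_{i=1}^r\binom{r-1}{i-1}M_{0^i}$ with $M_{0^i}=\sum_{1\le j_1<\dots<j_i}x_{j_1}^0\cdots x_{j_i}^0$). -}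

module Defs where

open import Data.Nat as ℕ using (ℕ; zero; suc; _∸_)
open import Data.Nat.Combinatorics using (_C_)
open import Data.Integer as ℤ using (ℤ; +_)
open import Data.Fin as Fin using (Fin)
open import Data.Fin.Properties as FinP using ()
open import Data.Maybe using (Maybe; nothing; just)
import Data.Maybe.Properties as MaybeP
open import Data.Vec as Vec using (Vec; []; _∷_; replicate; zipWith; _[_]≔_)
import Data.Vec.Properties as VecP
open import Data.List as List using (List; []; _∷_; map; concatMap; foldr; filter; upTo; allFin; cartesianProduct)
open import Data.List.Relation.Unary.Linked using (Linked; linked?)
open import Data.Product using (_×_; _,_)
open import Relation.Nullary.Decidable using (does; Dec)
open import Relation.Binary.PropositionalEquality using (_≡_)

-- A monomial of Z[[x_1,...,x_N]]_N : for each variable, `nothing` means the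
-- variable does not occur, `just a` means the factor x_i^a occurs (a = 0
-- allowed; x_i^0 is distinct from the absent variable).
Monomial : ℕ → Set
Monomial N = Vec (Maybe ℕ) N

_·ₑ_ : Maybe ℕ → Maybe ℕ → Maybe ℕ
nothing ·ₑ e = e
just a ·ₑ nothing = just a
just a ·ₑ just b = just (a ℕ.+ b)

_·ₘ_ : ∀ {N} → Monomial N → Monomial N → Monomial N
_·ₘ_ = zipWith _·ₑ_

oneₘ : ∀ {N} → Monomial N
oneₘ = replicate _ nothing

x⁰ : ∀ {N} → Fin N → Monomial N
x⁰ i = oneₘ [ i ]≔ just 0

_≟ₘ_ : ∀ {N} (μ ν : Monomial N) → Dec (μ ≡ ν)
_≟ₘ_ = VecP.≡-dec (MaybeP.≡-dec ℕ._≟_)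

factorsₑ : Maybe ℕ → List (Maybe ℕ × Maybe ℕ)
factorsₑ nothing = (nothing , nothing) ∷ []
factorsₑ (just a) = (nothing , just a) ∷ (just a , nothing)
  ∷ map (λ b → (just b , just (a ∸ b))) (upTo (suc a))

factorsₘ : ∀ {N} → Monomial N → List (Monomial N × Monomial N)
factorsₘ [] = ([] , []) ∷ []
factorsₘ (e ∷ μ) =
  map (λ { ((e₁ , e₂) , (μ₁ , μ₂)) → (e₁ ∷ μ₁ , e₂ ∷ μ₂) })
      (cartesianProduct (factorsₑ e) (factorsₘ μ))

Series : ℕ → Set
Series N = Monomial N → ℤ

sumℤ : List ℤ → ℤ
sumℤ = foldr ℤ._+_ (+ 0)

_+ₛ_ : ∀ {N} → Series N → Series N → Series N
(f +ₛ g) μ = f μ ℤ.+ g μ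

_•ₛ_ : ∀ {N} → ℤ → Series N → Series N
(c •ₛ f) μ = c ℤ.* f μ

0ₛ : ∀ {N} → Series N
0ₛ _ = + 0

_*ₛ_ : ∀ {N} → Series N → Series N → Series N
(f *ₛ g) μ = sumℤ (map (λ { (μ₁ , μ₂) → f μ₁ ℤ.* g μ₂ }) (factorsₘ μ))

sumMonomials : ∀ {N} → List (Monomial N) → Series N
sumMonomials ms μ = sumℤ (map (λ ν → if does (ν ≟ₘ μ) then + 1 else + 0) ms)
  where open import Data.Bool using (if_then_else_)

sequences : (N r : ℕ) → List (List (Fin N))
sequences N zero = [] ∷ []
sequences N (suc r) = concatMap (λ i → map (i ∷_) (sequences N r)) (allFin N)

weaklyIncreasing : (N r : ℕ) → List (List (Fin N))
weaklyIncreasing N r = filter (linked? Fin._≤?_) (sequences N r)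

monomialOf : ∀ {N} → List (Fin N) → Monomial N
monomialOf = foldr (λ i μ → x⁰ i ·ₘ μ) oneₘ

F0 : (N r : ℕ) → Series N
F0 N r = sumMonomials (map monomialOf (weaklyIncreasing N r))

_≈ₛ_ : ∀ {N} → Series N → Series N → Set
f ≈ₛ g = ∀ μ → f μ ≡ g μ

Σₛ[j≤_]_ : ∀ {N} → ℕ → (ℕ → Series N) → Series N
Σₛ[j≤ m ] s = foldr (λ j acc → s j +ₛ acc) 0ₛ (upTo (suc m))

sign : ℕ → ℤ
sign zero = + 1
sign (suc j) = ℤ.- sign j

-- Fix a monomial μ, let v r be its coefficient in F_{0^r}, and let
-- RHS v m n = Σ_{j ≤ m} coeff m n j · v (m + n - j) be its coefficient on the right.
-- Every F_{0^r} involves only exponents 0, and prepending a variable with exponent 0 to μ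
-- replaces v by its strict partial sums r ↦ Σ_{s<r} v s (F0coeff), while it replaces the
-- product coefficient T m n by (Σ_{s ≤ m, t ≤ n} T s t) − T m n (prodCoeff-x⁰).  The heart of
-- the proof is that RHS intertwines these two operations (RHS-strictPartialSums); this is an
-- induction on (m , n), because the coefficients satisfy a Pascal-type recursion
-- (coeff-pascal, lifted to RHS-step) matching the inclusion–exclusion recursion of rectangle
-- sums.  The theorem then follows by induction over the variables of μ (prodCoeff≡RHS).
--
-- The identity holds for all m, n.
module Submission where

open import Defs
open import Data.Nat using (ℕ; _≤_; _+_; _∸_)
open import Data.Nat.Combinatorics using (_C_)
open import Data.Integer using (+_; _*_)

open import Data.Nat using (zero; suc; _<_; z≤n; s≤s)
import Data.Nat as ℕ
import Data.Nat.Properties as ℕP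
import Data.Nat.Tactic.RingSolver as ℕS
open import Data.Nat.Combinatorics using (nCn≡1; k>n⇒nCk≡0; nCk+nC[k+1]≡[n+1]C[k+1])
open import Data.Integer using (ℤ; -_) renaming (_+_ to _⊕_)
import Data.Integer.Properties as ℤP
open import Data.Integer.Tactic.RingSolver using (solve-∀)
open import Data.Bool using (Bool; true; false; if_then_else_)
open import Data.Fin using (Fin; toℕ) renaming (zero to fzero; suc to fsuc)
open import Data.Fin.Properties using (_≤?_)
open import Data.Maybe using (Maybe; nothing; just; is-nothing)
open import Data.Vec using ([]; _∷_)
open import Data.List using (List; []; _∷_; _++_; map; concatMap; filter; foldr; upTo; allFin; cartesianProduct)
open import Data.List.Properties using (map-cong; map-cong-local; map-∘; map-upTo; upTo-∷ʳ; map-tabulate)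
open import Data.List.Relation.Unary.All using (All)
open import Data.List.Relation.Unary.All.Properties using (applyUpTo⁺₁)
open import Data.List.Relation.Unary.Linked using (linked?)
open import Data.Product using (_×_; _,_; proj₁; proj₂)
open import Function using (_∘_)
open import Relation.Nullary using (yes; no)
open import Relation.Nullary.Decidable using (Dec; does)
open import Relation.Binary.PropositionalEquality
  using (_≡_; refl; sym; trans; cong; cong₂; module ≡-Reasoning)

∑ : ∀ {a} {A : Set a} → (A → ℤ) → List A → ℤ
∑ f xs = sumℤ (map f xs)

module _ {a} {A : Set a} where

  ∑-cong : ∀ {f g : A → ℤ} → (∀ x → f x ≡ g x) → ∀ xs → ∑ f xs ≡ ∑ g xs
  ∑-cong f≗g xs = cong sumℤ (map-cong f≗g xs)

  ∑-cong-local : ∀ {f g : A → ℤ} {xs} → All (λ x → f x ≡ g x) xs → ∑ f xs ≡ ∑ g xs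
  ∑-cong-local eqs = cong sumℤ (map-cong-local eqs)

  ∑-zero : ∀ (f : A → ℤ) → (∀ x → f x ≡ + 0) → ∀ xs → ∑ f xs ≡ + 0
  ∑-zero f f≡0 []       = refl
  ∑-zero f f≡0 (x ∷ xs) = cong₂ _⊕_ (f≡0 x) (∑-zero f f≡0 xs)

  ∑-++ : ∀ (f : A → ℤ) xs ys → ∑ f (xs ++ ys) ≡ ∑ f xs ⊕ ∑ f ys
  ∑-++ f []       ys = sym (ℤP.+-identityˡ (∑ f ys))
  ∑-++ f (x ∷ xs) ys = trans (cong (f x ⊕_) (∑-++ f xs ys)) (sym (ℤP.+-assoc (f x) _ _))

  ∑-+ : ∀ (f g : A → ℤ) xs → ∑ (λ x → f x ⊕ g x) xs ≡ ∑ f xs ⊕ ∑ g xs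
  ∑-+ f g []       = refl
  ∑-+ f g (x ∷ xs) = trans (cong (f x ⊕ g x ⊕_) (∑-+ f g xs)) (interchange (f x) (g x) _ _)
    where
    interchange : ∀ a b c d → a ⊕ b ⊕ (c ⊕ d) ≡ a ⊕ c ⊕ (b ⊕ d)
    interchange = solve-∀

  ∑-neg : ∀ (f : A → ℤ) xs → ∑ (λ x → - f x) xs ≡ - ∑ f xs
  ∑-neg f []       = refl
  ∑-neg f (x ∷ xs) = trans (cong (- f x ⊕_) (∑-neg f xs)) (sym (ℤP.neg-distrib-+ (f x) _))

  ∑-*ˡ : ∀ c (f : A → ℤ) xs → ∑ (λ x → c * f x) xs ≡ c * ∑ f xs
  ∑-*ˡ c f []       = sym (ℤP.*-zeroʳ c)
  ∑-*ˡ c f (x ∷ xs) = trans (cong (c * f x ⊕_) (∑-*ˡ c f xs)) (sym (ℤP.*-distribˡ-+ c (f x) _))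

  ∑-*ʳ : ∀ c (f : A → ℤ) xs → ∑ (λ x → f x * c) xs ≡ ∑ f xs * c
  ∑-*ʳ c f xs = trans (∑-cong (λ x → ℤP.*-comm (f x) c) xs) (trans (∑-*ˡ c f xs) (ℤP.*-comm c _))

  ∑-filter : ∀ {p} {P : A → Set p} (P? : ∀ x → Dec (P x)) (f : A → ℤ) xs →
    ∑ f (filter P? xs) ≡ ∑ (λ x → if does (P? x) then f x else + 0) xs
  ∑-filter P? f []       = refl
  ∑-filter P? f (x ∷ xs) with does (P? x)
  ... | true  = cong (f x ⊕_) (∑-filter P? f xs)
  ... | false = trans (∑-filter P? f xs) (sym (ℤP.+-identityˡ _))

  ∑-if : ∀ b (f : A → ℤ) xs → ∑ (λ x → if b then f x else + 0) xs ≡ (if b then ∑ f xs else + 0)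
  ∑-if true  f xs = refl
  ∑-if false f xs = ∑-zero _ (λ _ → refl) xs

∑-map : ∀ {a b} {A : Set a} {B : Set b} (f : B → ℤ) (g : A → B) xs →
  ∑ f (map g xs) ≡ ∑ (f ∘ g) xs
∑-map f g xs = cong sumℤ (sym (map-∘ xs))

module _ {a b} {A : Set a} {B : Set b} where

  ∑-concatMap : ∀ (f : B → ℤ) (g : A → List B) xs →
    ∑ f (concatMap g xs) ≡ ∑ (λ x → ∑ f (g x)) xs
  ∑-concatMap f g []       = refl
  ∑-concatMap f g (x ∷ xs) =
    trans (∑-++ f (g x) (concatMap g xs)) (cong (∑ f (g x) ⊕_) (∑-concatMap f g xs))

  ∑-cartesianProduct : ∀ (f : A × B → ℤ) xs ys →
    ∑ f (cartesianProduct xs ys) ≡ ∑ (λ x → ∑ (λ y → f (x , y)) ys) xs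
  ∑-cartesianProduct f []       ys = refl
  ∑-cartesianProduct f (x ∷ xs) ys =
    trans (∑-++ f (map (x ,_) ys) (cartesianProduct xs ys))
          (cong₂ _⊕_ (∑-map f (x ,_) ys) (∑-cartesianProduct f xs ys))

  ∑-comm : ∀ (h : A → B → ℤ) xs ys →
    ∑ (λ x → ∑ (h x) ys) xs ≡ ∑ (λ y → ∑ (λ x → h x y) xs) ys
  ∑-comm h []       ys = sym (∑-zero _ (λ _ → refl) ys)
  ∑-comm h (x ∷ xs) ys =
    trans (cong (∑ (h x) ys ⊕_) (∑-comm h xs ys)) (sym (∑-+ (h x) _ ys))

∑< : ℕ → (ℕ → ℤ) → ℤ
∑< k f = ∑ f (upTo k)

∑<-suc : ∀ k f → ∑< (suc k) f ≡ f 0 ⊕ ∑< k (f ∘ suc)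
∑<-suc k f = cong (f 0 ⊕_) (trans (cong (∑ f) (sym (map-upTo suc k))) (∑-map f suc (upTo k)))

∑<-last : ∀ k f → ∑< (suc k) f ≡ ∑< k f ⊕ f k
∑<-last k f = begin
  ∑ f (upTo (suc k))             ≡⟨ cong (∑ f) (sym (upTo-∷ʳ k)) ⟩
  ∑ f (upTo k ++ k ∷ [])         ≡⟨ ∑-++ f (upTo k) (k ∷ []) ⟩
  ∑< k f ⊕ (f k ⊕ + 0)           ≡⟨ cong (∑< k f ⊕_) (ℤP.+-identityʳ (f k)) ⟩
  ∑< k f ⊕ f k                   ∎
  where open ≡-Reasoning

∑<-cong : ∀ k {f g : ℕ → ℤ} → (∀ {i} → i < k → f i ≡ g i) → ∑< k f ≡ ∑< k g
∑<-cong k f≡g = ∑-cong-local (applyUpTo⁺₁ (λ i → i) k f≡g)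

∑≤² : (ℕ → ℕ → ℤ) → ℕ → ℕ → ℤ
∑≤² f m n = ∑< (suc m) (λ s → ∑< (suc n) (f s))

-- Inclusion–exclusion: the rectangle [0,m+1]×[0,n+1] is the union of [0,m]×[0,n+1] and
-- [0,m+1]×[0,n] (overlapping in [0,m]×[0,n]) and the corner (m+1,n+1).
∑≤²-step : ∀ f m n →
  ∑≤² f (suc m) (suc n) ≡ ∑≤² f m (suc n) ⊕ ∑≤² f (suc m) n ⊕ - ∑≤² f m n ⊕ f (suc m) (suc n)
∑≤²-step f m n = begin
  ∑≤² f (suc m) (suc n)
    ≡⟨ ∑<-last (suc m) (λ s → ∑< (suc (suc n)) (f s)) ⟩
  ∑≤² f m (suc n) ⊕ ∑< (suc (suc n)) (f (suc m))
    ≡⟨ cong (∑≤² f m (suc n) ⊕_) (∑<-last (suc n) (f (suc m))) ⟩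
  ∑≤² f m (suc n) ⊕ (row ⊕ corner)
    ≡⟨ regroup (∑≤² f m (suc n)) (∑≤² f m n) row corner ⟩
  ∑≤² f m (suc n) ⊕ (∑≤² f m n ⊕ row) ⊕ - ∑≤² f m n ⊕ corner
    ≡⟨ cong (λ x → ∑≤² f m (suc n) ⊕ x ⊕ - ∑≤² f m n ⊕ corner) (∑<-last (suc m) (λ s → ∑< (suc n) (f s))) ⟨
  ∑≤² f m (suc n) ⊕ ∑≤² f (suc m) n ⊕ - ∑≤² f m n ⊕ corner ∎
  where
  open ≡-Reasoning
  row corner : ℤ
  row = ∑< (suc n) (f (suc m))
  corner = f (suc m) (suc n)
  regroup : ∀ a b x y → a ⊕ (x ⊕ y) ≡ a ⊕ (b ⊕ x) ⊕ - b ⊕ y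
  regroup = solve-∀

∑≤²-cong : ∀ {f g : ℕ → ℕ → ℤ} → (∀ s t → f s t ≡ g s t) → ∀ m n → ∑≤² f m n ≡ ∑≤² g m n
∑≤²-cong f≗g m n = ∑-cong (λ s → ∑-cong (f≗g s) (upTo (suc n))) (upTo (suc m))

∑-bilinear : ∀ {a} {A : Set a} (f g : ℕ → A → ℤ) k l xs →
  ∑ (λ x → ∑< k (λ s → f s x) * ∑< l (λ t → g t x)) xs ≡
  ∑< k (λ s → ∑< l (λ t → ∑ (λ x → f s x * g t x) xs))
∑-bilinear f g k l xs = begin
  ∑ (λ x → ∑< k (λ s → f s x) * ∑< l (λ t → g t x)) xs
    ≡⟨ ∑-cong expand xs ⟩
  ∑ (λ x → ∑< k (λ s → ∑< l (λ t → f s x * g t x))) xs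
    ≡⟨ ∑-comm (λ x s → ∑< l (λ t → f s x * g t x)) xs (upTo k) ⟩
  ∑< k (λ s → ∑ (λ x → ∑< l (λ t → f s x * g t x)) xs)
    ≡⟨ ∑-cong (λ s → ∑-comm (λ x t → f s x * g t x) xs (upTo l)) (upTo k) ⟩
  ∑< k (λ s → ∑< l (λ t → ∑ (λ x → f s x * g t x) xs)) ∎
  where
  open ≡-Reasoning
  expand : ∀ x → ∑< k (λ s → f s x) * ∑< l (λ t → g t x) ≡ ∑< k (λ s → ∑< l (λ t → f s x * g t x))
  expand x = trans (sym (∑-*ʳ (∑< l (λ t → g t x)) (λ s → f s x) (upTo k)))
                   (∑-cong (λ s → sym (∑-*ˡ (f s x) (λ t → g t x) (upTo l))) (upTo k))

coeff : ℕ → ℕ → ℕ → ℤ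
coeff m n j = sign j * (+ (m C j) * + ((m + n ∸ j) C m))

weight : ℕ → ℕ → ℕ → ℕ
weight m n j = (m C j) ℕ.* ((m + n ∸ j) C m)

coeff≡±weight : ∀ m n j → coeff m n j ≡ sign j * + weight m n j
coeff≡±weight m n j = cong (sign j *_) (sym (ℤP.pos-* (m C j) ((m + n ∸ j) C m)))

∸-cancel-suc : ∀ m n j → m + suc n ∸ suc j ≡ m + n ∸ j
∸-cancel-suc m n j = cong (_∸ suc j) (ℕP.+-suc m n)

+suc-∸ : ∀ {m} n {j} → j ≤ m → m + suc n ∸ j ≡ suc (m + n ∸ j)
+suc-∸ {m} n {j} j≤m =
  trans (cong (_∸ j) (ℕP.+-suc m n)) (ℕP.+-∸-assoc 1 (ℕP.≤-trans j≤m (ℕP.m≤m+n m n)))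

-- Pascal-type recursion for the weights, from Pascal's rule applied to both binomials:
-- C(m+1,j+1) C(K+1,m+1) = (C(m,j+1) + C(m,j)) (C(K,m) + C(K,m+1)) with K = m+n-j.
weight-pascal₀ : ∀ m n → weight (suc m) (suc n) 0 ≡ weight m (suc n) 0 ℕ.+ weight (suc m) n 0
weight-pascal₀ m n = begin
  1 ℕ.* (suc (m + suc n) C suc m)
    ≡⟨ ℕP.*-identityˡ _ ⟩
  suc (m + suc n) C suc m
    ≡⟨ cong (λ k → suc k C suc m) (ℕP.+-suc m n) ⟩
  suc (suc (m + n)) C suc m
    ≡⟨ nCk+nC[k+1]≡[n+1]C[k+1] (suc (m + n)) m ⟨
  suc (m + n) C m ℕ.+ suc (m + n) C suc m
    ≡⟨ cong₂ (λ k l → k C m ℕ.+ l) (ℕP.+-suc m n) (ℕP.*-identityˡ _) ⟨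
  (m + suc n) C m ℕ.+ 1 ℕ.* ((suc m + n) C suc m)
    ≡⟨ cong (ℕ._+ weight (suc m) n 0) (ℕP.*-identityˡ ((m + suc n) C m)) ⟨
  weight m (suc n) 0 ℕ.+ weight (suc m) n 0 ∎
  where open ≡-Reasoning

weight-pascal : ∀ m n j →
  weight (suc m) (suc n) (suc j) ≡ weight m (suc n) (suc j) ℕ.+ weight (suc m) n (suc j) ℕ.+ weight m n j
weight-pascal m n j with j ℕP.≤? m
... | yes j≤m = begin
  (suc m C suc j) ℕ.* ((m + suc n ∸ j) C suc m)
    ≡⟨ cong (λ k → (suc m C suc j) ℕ.* (k C suc m)) (+suc-∸ n j≤m) ⟩
  (suc m C suc j) ℕ.* (suc K C suc m)
    ≡⟨ cong₂ ℕ._*_ (nCk+nC[k+1]≡[n+1]C[k+1] m j) (nCk+nC[k+1]≡[n+1]C[k+1] K m) ⟨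
  (a ℕ.+ b) ℕ.* (c ℕ.+ d)
    ≡⟨ expand a b c d ⟩
  b ℕ.* c ℕ.+ (a ℕ.+ b) ℕ.* d ℕ.+ a ℕ.* c
    ≡⟨ cong₂ (λ k l → b ℕ.* (k C m) ℕ.+ l ℕ.* d ℕ.+ a ℕ.* c)
             (sym (∸-cancel-suc m n j)) (nCk+nC[k+1]≡[n+1]C[k+1] m j) ⟩
  weight m (suc n) (suc j) ℕ.+ weight (suc m) n (suc j) ℕ.+ weight m n j ∎
  where
  open ≡-Reasoning
  K a b c d : ℕ
  K = m + n ∸ j
  a = m C j
  b = m C suc j
  c = K C m
  d = K C suc m
  expand : ∀ a b c d → (a ℕ.+ b) ℕ.* (c ℕ.+ d) ≡ b ℕ.* c ℕ.+ (a ℕ.+ b) ℕ.* d ℕ.+ a ℕ.* c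
  expand = ℕS.solve-∀
-- for j > m every term contains one of C(m+1, j+1), C(m, j+1), C(m, j), which all vanish
... | no j≰m
  rewrite k>n⇒nCk≡0 {suc m} {suc j} (s≤s (ℕP.≰⇒> j≰m))
        | k>n⇒nCk≡0 {m} {suc j} (ℕP.m<n⇒m<1+n (ℕP.≰⇒> j≰m))
        | k>n⇒nCk≡0 {m} {j} (ℕP.≰⇒> j≰m) = refl

*-pos-+ : ∀ s a b → s * + (a ℕ.+ b) ≡ s * + a ⊕ s * + b
*-pos-+ s a b = trans (cong (s *_) (ℤP.pos-+ a b)) (ℤP.*-distribˡ-+ s (+ a) (+ b))

coeff-pascal₀ : ∀ m n → coeff (suc m) (suc n) 0 ≡ coeff m (suc n) 0 ⊕ coeff (suc m) n 0
coeff-pascal₀ m n = begin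
  coeff (suc m) (suc n) 0           ≡⟨ coeff≡±weight (suc m) (suc n) 0 ⟩
  + 1 * + weight (suc m) (suc n) 0  ≡⟨ cong (λ w → + 1 * + w) (weight-pascal₀ m n) ⟩
  + 1 * + (w₁ ℕ.+ w₂)               ≡⟨ *-pos-+ (+ 1) w₁ w₂ ⟩
  + 1 * + w₁ ⊕ + 1 * + w₂           ≡⟨ cong₂ _⊕_ (coeff≡±weight m (suc n) 0) (coeff≡±weight (suc m) n 0) ⟨
  coeff m (suc n) 0 ⊕ coeff (suc m) n 0 ∎
  where
  open ≡-Reasoning
  w₁ w₂ : ℕ
  w₁ = weight m (suc n) 0
  w₂ = weight (suc m) n 0

coeff-pascal : ∀ m n j →
  coeff (suc m) (suc n) (suc j) ≡ coeff m (suc n) (suc j) ⊕ coeff (suc m) n (suc j) ⊕ - coeff m n j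
coeff-pascal m n j = begin
  coeff (suc m) (suc n) (suc j)         ≡⟨ coeff≡±weight (suc m) (suc n) (suc j) ⟩
  s * + weight (suc m) (suc n) (suc j)  ≡⟨ cong (λ w → s * + w) (weight-pascal m n j) ⟩
  s * + (w₁ ℕ.+ w₂ ℕ.+ w₃)             ≡⟨ *-pos-+ s (w₁ ℕ.+ w₂) w₃ ⟩
  s * + (w₁ ℕ.+ w₂) ⊕ s * + w₃
    ≡⟨ cong₂ _⊕_ (*-pos-+ s w₁ w₂) (sym (ℤP.neg-distribˡ-* (sign j) (+ w₃))) ⟩
  s * + w₁ ⊕ s * + w₂ ⊕ - (sign j * + w₃)
    ≡⟨ cong₂ _⊕_ (cong₂ _⊕_ (coeff≡±weight m (suc n) (suc j)) (coeff≡±weight (suc m) n (suc j)))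
                 (cong -_ (coeff≡±weight m n j)) ⟨
  coeff m (suc n) (suc j) ⊕ coeff (suc m) n (suc j) ⊕ - coeff m n j ∎
  where
  open ≡-Reasoning
  s : ℤ
  s = sign (suc j)
  w₁ w₂ w₃ : ℕ
  w₁ = weight m (suc n) (suc j)
  w₂ = weight (suc m) n (suc j)
  w₃ = weight m n j

coeff-zeroˡ : ∀ m n j → m C j ≡ 0 → coeff m n j ≡ + 0
coeff-zeroˡ m n j eq rewrite eq = ℤP.*-zeroʳ (sign j)

coeff-zeroʳ : ∀ m n j → (m + n ∸ j) C m ≡ 0 → coeff m n j ≡ + 0
coeff-zeroʳ m n j eq rewrite eq = trans (cong (sign j *_) (ℤP.*-zeroʳ (+ (m C j)))) (ℤP.*-zeroʳ (sign j))

-- The right-hand side of the theorem at a fixed monomial, as an operator on the sequence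
-- g r = (coefficient of that monomial in F_{0^r}):  RHS g m n = Σ_{j ≤ m} coeff m n j · g (m + n - j).
RHS : (ℕ → ℤ) → ℕ → ℕ → ℤ
RHS g m n = ∑< (suc m) (λ j → coeff m n j * g (m + n ∸ j))

RHS-cong : ∀ {g h : ℕ → ℤ} m n → (∀ r → g r ≡ h r) → RHS g m n ≡ RHS h m n
RHS-cong m n g≗h = ∑-cong (λ j → cong (coeff m n j *_) (g≗h (m + n ∸ j))) (upTo (suc m))

RHS-+ : ∀ g h m n → RHS (λ r → g r ⊕ h r) m n ≡ RHS g m n ⊕ RHS h m n
RHS-+ g h m n = begin
  RHS (λ r → g r ⊕ h r) m n
    ≡⟨ ∑-cong (λ j → ℤP.*-distribˡ-+ (coeff m n j) (g (m + n ∸ j)) (h (m + n ∸ j))) (upTo (suc m)) ⟩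
  ∑< (suc m) (λ j → coeff m n j * g (m + n ∸ j) ⊕ coeff m n j * h (m + n ∸ j))
    ≡⟨ ∑-+ (λ j → coeff m n j * g (m + n ∸ j)) (λ j → coeff m n j * h (m + n ∸ j)) (upTo (suc m)) ⟩
  RHS g m n ⊕ RHS h m n ∎
  where open ≡-Reasoning

RHS-0ˡ : ∀ g n → RHS g 0 n ≡ g n
RHS-0ˡ g n = trans (ℤP.+-identityʳ _) (ℤP.*-identityˡ (g n))

RHS-0ʳ : ∀ g m → RHS g m 0 ≡ g m
RHS-0ʳ g m = begin
  RHS g m 0
    ≡⟨ ∑<-suc m (λ j → coeff m 0 j * g (m + 0 ∸ j)) ⟩
  coeff m 0 0 * g (m + 0) ⊕ ∑< m (λ j → coeff m 0 (suc j) * g (m + 0 ∸ suc j))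
    ≡⟨ cong₂ _⊕_ first (∑<-cong m rest) ⟩
  g m ⊕ ∑< m (λ _ → + 0)  ≡⟨ cong (g m ⊕_) (∑-zero _ (λ _ → refl) (upTo m)) ⟩
  g m ⊕ + 0               ≡⟨ ℤP.+-identityʳ (g m) ⟩
  g m                     ∎
  where
  open ≡-Reasoning
  first : coeff m 0 0 * g (m + 0) ≡ g m
  first rewrite ℕP.+-identityʳ m | nCn≡1 m = ℤP.*-identityˡ (g m)
  -- for j ≥ 1 the binomial C(m - j, m) vanishes
  rest : ∀ {j} → j < m → coeff m 0 (suc j) * g (m + 0 ∸ suc j) ≡ + 0
  rest {j} j<m = trans (cong (_* G) (coeff-zeroʳ m 0 (suc j) (k>n⇒nCk≡0 m-j-1<m))) (ℤP.*-zeroˡ G)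
    where
    G : ℤ
    G = g (m + 0 ∸ suc j)
    m-j-1<m : m + 0 ∸ suc j < m
    m-j-1<m rewrite ℕP.+-identityʳ m = ℕP.∸-monoʳ-< (s≤s z≤n) j<m

-- The Pascal recursion for coefficients lifts to RHS: each term of RHS g (m+1) (n+1) splits
-- into terms of the three shifted right-hand sides, the last one with index j - 1.
RHS-step : ∀ g m n →
  RHS g (suc m) (suc n) ≡ RHS (g ∘ suc) m (suc n) ⊕ RHS (g ∘ suc) (suc m) n ⊕ - RHS (g ∘ suc) m n
RHS-step g m n = begin
  RHS g (suc m) (suc n)
    ≡⟨ ∑<-cong (suc (suc m)) (λ {j} j<m+2 → term-step j (ℕP.≤-pred j<m+2)) ⟩
  ∑< (suc (suc m)) (λ j → A j ⊕ B j ⊕ Q j)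
    ≡⟨ ∑-+ (λ j → A j ⊕ B j) Q (upTo (suc (suc m))) ⟩
  ∑< (suc (suc m)) (λ j → A j ⊕ B j) ⊕ ∑< (suc (suc m)) Q
    ≡⟨ cong (_⊕ ∑< (suc (suc m)) Q) (∑-+ A B (upTo (suc (suc m)))) ⟩
  ∑< (suc (suc m)) A ⊕ ∑< (suc (suc m)) B ⊕ ∑< (suc (suc m)) Q
    ≡⟨ cong₂ (λ x y → x ⊕ ∑< (suc (suc m)) B ⊕ y) ∑A ∑Q ⟩
  RHS (g ∘ suc) m (suc n) ⊕ RHS (g ∘ suc) (suc m) n ⊕ - RHS (g ∘ suc) m n ∎
  where
  open ≡-Reasoning
  A B Q : ℕ → ℤ
  A j = coeff m (suc n) j * g (suc (m + suc n ∸ j))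
  B j = coeff (suc m) n j * g (suc (suc m + n ∸ j))
  Q zero    = + 0
  Q (suc j) = - (coeff m n j * g (suc (m + n ∸ j)))

  distrib : ∀ a b c x → (a ⊕ b ⊕ - c) * x ≡ a * x ⊕ b * x ⊕ - (c * x)
  distrib = solve-∀

  term-step : ∀ j → j ≤ suc m → coeff (suc m) (suc n) j * g (suc m + suc n ∸ j) ≡ A j ⊕ B j ⊕ Q j
  term-step zero _ = begin
    coeff (suc m) (suc n) 0 * G
      ≡⟨ cong (_* G) (coeff-pascal₀ m n) ⟩
    (coeff m (suc n) 0 ⊕ coeff (suc m) n 0) * G
      ≡⟨ ℤP.*-distribʳ-+ G (coeff m (suc n) 0) (coeff (suc m) n 0) ⟩
    coeff m (suc n) 0 * G ⊕ coeff (suc m) n 0 * G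
      ≡⟨ cong (λ k → coeff m (suc n) 0 * G ⊕ coeff (suc m) n 0 * g (suc k)) (ℕP.+-suc m n) ⟩
    A 0 ⊕ B 0                                      ≡⟨ ℤP.+-identityʳ _ ⟨
    A 0 ⊕ B 0 ⊕ + 0                                ∎
    where
    G : ℤ
    G = g (suc (m + suc n))
  term-step (suc j) (s≤s j≤m) = begin
    coeff (suc m) (suc n) (suc j) * g (m + suc n ∸ j)
      ≡⟨ cong (λ k → coeff (suc m) (suc n) (suc j) * g k) (+suc-∸ n j≤m) ⟩
    coeff (suc m) (suc n) (suc j) * G
      ≡⟨ cong (_* G) (coeff-pascal m n j) ⟩
    (coeff m (suc n) (suc j) ⊕ coeff (suc m) n (suc j) ⊕ - coeff m n j) * G
      ≡⟨ distrib (coeff m (suc n) (suc j)) (coeff (suc m) n (suc j)) (coeff m n j) G ⟩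
    coeff m (suc n) (suc j) * G ⊕ B (suc j) ⊕ Q (suc j)
      ≡⟨ cong (λ k → coeff m (suc n) (suc j) * g (suc k) ⊕ B (suc j) ⊕ Q (suc j)) (∸-cancel-suc m n j) ⟨
    A (suc j) ⊕ B (suc j) ⊕ Q (suc j)                     ∎
    where
    G : ℤ
    G = g (suc (m + n ∸ j))

  -- the extra term j = m + 1 vanishes since C(m, m+1) = 0
  ∑A : ∑< (suc (suc m)) A ≡ RHS (g ∘ suc) m (suc n)
  ∑A = begin
    ∑< (suc (suc m)) A               ≡⟨ ∑<-last (suc m) A ⟩
    RHS (g ∘ suc) m (suc n) ⊕ A (suc m)
      ≡⟨ cong (λ x → RHS (g ∘ suc) m (suc n) ⊕ x * g (suc (m + suc n ∸ suc m)))
              (coeff-zeroˡ m (suc n) (suc m) (k>n⇒nCk≡0 (ℕP.n<1+n m))) ⟩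
    RHS (g ∘ suc) m (suc n) ⊕ + 0    ≡⟨ ℤP.+-identityʳ _ ⟩
    RHS (g ∘ suc) m (suc n)          ∎

  ∑Q : ∑< (suc (suc m)) Q ≡ - RHS (g ∘ suc) m n
  ∑Q = trans (∑<-suc (suc m) Q) (trans (ℤP.+-identityˡ (∑< (suc m) (Q ∘ suc)))
         (∑-neg (λ j → coeff m n j * g (suc (m + n ∸ j))) (upTo (suc m))))

-- Both sides satisfy the same boundary values and the same
-- recursion (RHS-step resp. ∑≤²-step), so this is an induction on (m , n).
RHS-partialSums : ∀ v m n → RHS (λ r → ∑< (suc r) v) m n ≡ ∑≤² (RHS v) m n
RHS-partialSums v zero n = begin
  RHS W 0 n                         ≡⟨ RHS-0ˡ W n ⟩
  ∑< (suc n) v                      ≡⟨ ∑-cong (λ t → RHS-0ˡ v t) (upTo (suc n)) ⟨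
  ∑< (suc n) (RHS v 0)              ≡⟨ ℤP.+-identityʳ _ ⟨
  ∑≤² (RHS v) 0 n                   ∎
  where
  open ≡-Reasoning
  W : ℕ → ℤ
  W r = ∑< (suc r) v
RHS-partialSums v (suc m) zero = begin
  RHS W (suc m) 0                   ≡⟨ RHS-0ʳ W (suc m) ⟩
  ∑< (suc (suc m)) v
    ≡⟨ ∑-cong (λ s → trans (ℤP.+-identityʳ (RHS v s 0)) (RHS-0ʳ v s)) (upTo (suc (suc m))) ⟨
  ∑≤² (RHS v) (suc m) 0             ∎
  where
  open ≡-Reasoning
  W : ℕ → ℤ
  W r = ∑< (suc r) v
RHS-partialSums v (suc m) (suc n) = begin
  RHS W (suc m) (suc n)
    ≡⟨ RHS-step W m n ⟩
  RHS (W ∘ suc) m (suc n) ⊕ RHS (W ∘ suc) (suc m) n ⊕ - RHS (W ∘ suc) m n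
    ≡⟨ cong₂ _⊕_ (cong₂ _⊕_ (shifted m (suc n) (RHS-partialSums v m (suc n)))
                            (shifted (suc m) n (RHS-partialSums v (suc m) n)))
                 (cong -_ (shifted m n (RHS-partialSums v m n))) ⟩
  (S m (suc n) ⊕ V m (suc n)) ⊕ (S (suc m) n ⊕ V (suc m) n) ⊕ - (S m n ⊕ V m n)
    ≡⟨ regroup (S m (suc n)) (S (suc m) n) (S m n) (V m (suc n)) (V (suc m) n) (V m n) ⟩
  S m (suc n) ⊕ S (suc m) n ⊕ - S m n ⊕ (V m (suc n) ⊕ V (suc m) n ⊕ - V m n)
    ≡⟨ cong (S m (suc n) ⊕ S (suc m) n ⊕ - S m n ⊕_) (RHS-step v m n) ⟨
  S m (suc n) ⊕ S (suc m) n ⊕ - S m n ⊕ RHS v (suc m) (suc n)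
    ≡⟨ ∑≤²-step (RHS v) m n ⟨
  ∑≤² (RHS v) (suc m) (suc n) ∎
  where
  open ≡-Reasoning
  W : ℕ → ℤ
  W r = ∑< (suc r) v
  S V : ℕ → ℕ → ℤ
  S = ∑≤² (RHS v)
  V = RHS (v ∘ suc)
  -- W (r + 1) = W r + v (r + 1), so by linearity:
  shifted : ∀ a b → RHS W a b ≡ S a b → RHS (W ∘ suc) a b ≡ S a b ⊕ V a b
  shifted a b ih = begin
    RHS (W ∘ suc) a b                          ≡⟨ RHS-cong a b (λ r → ∑<-last (suc r) v) ⟩
    RHS (λ r → W r ⊕ v (suc r)) a b            ≡⟨ RHS-+ W (v ∘ suc) a b ⟩
    RHS W a b ⊕ V a b                          ≡⟨ cong (_⊕ V a b) ih ⟩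
    S a b ⊕ V a b                              ∎
  regroup : ∀ a₁ a₂ a₃ b₁ b₂ b₃ →
    (a₁ ⊕ b₁) ⊕ (a₂ ⊕ b₂) ⊕ - (a₃ ⊕ b₃) ≡ a₁ ⊕ a₂ ⊕ - a₃ ⊕ (b₁ ⊕ b₂ ⊕ - b₃)
  regroup = solve-∀

RHS-strictPartialSums : ∀ v m n → RHS (λ r → ∑< r v) m n ≡ ∑≤² (RHS v) m n ⊕ - RHS v m n
RHS-strictPartialSums v m n = begin
  X                                       ≡⟨ cancel X (RHS v m n) ⟩
  X ⊕ RHS v m n ⊕ - RHS v m n             ≡⟨ cong (_⊕ - RHS v m n) (RHS-+ (λ r → ∑< r v) v m n) ⟨
  RHS (λ r → ∑< r v ⊕ v r) m n ⊕ - RHS v m n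
    ≡⟨ cong (_⊕ - RHS v m n) (RHS-cong m n (λ r → ∑<-last r v)) ⟨
  RHS (λ r → ∑< (suc r) v) m n ⊕ - RHS v m n
    ≡⟨ cong (_⊕ - RHS v m n) (RHS-partialSums v m n) ⟩
  ∑≤² (RHS v) m n ⊕ - RHS v m n           ∎
  where
  open ≡-Reasoning
  X : ℤ
  X = RHS (λ r → ∑< r v) m n
  cancel : ∀ x y → x ≡ x ⊕ y ⊕ - y
  cancel = solve-∀

RHS-zero : ∀ m n → RHS (λ _ → + 0) m n ≡ + 0
RHS-zero m n = ∑-zero _ (λ j → ℤP.*-zeroʳ (coeff m n j)) (upTo (suc m))

isZero : ℕ → ℤ
isZero zero    = + 1
isZero (suc _) = + 0

-- For the empty monomial: F_{0^m} · F_{0^n} has constant term [m = 0][n = 0].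
RHS-isZero : ∀ m n → RHS isZero m n ≡ isZero m * isZero n
RHS-isZero zero    n       = trans (RHS-0ˡ isZero n) (sym (ℤP.*-identityˡ (isZero n)))
RHS-isZero (suc m) zero    = RHS-0ʳ isZero (suc m)
RHS-isZero (suc m) (suc n) =
  trans (∑<-cong (suc (suc m)) positive) (∑-zero _ (λ _ → refl) (upTo (suc (suc m))))
  where
  -- every index suc m + suc n ∸ j with j ≤ suc m is positive
  positive : ∀ {j} → j < suc (suc m) → coeff (suc m) (suc n) j * isZero (suc m + suc n ∸ j) ≡ + 0
  positive {j} (s≤s j≤m+1) =
    trans (cong (λ k → coeff (suc m) (suc n) j * isZero k) (+suc-∸ {suc m} n j≤m+1))
          (ℤP.*-zeroʳ (coeff (suc m) (suc n) j))

onIncreasing : ∀ {N} → (List (Fin N) → ℤ) → List (Fin N) → ℤ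
onIncreasing g σ = if does (linked? _≤?_ σ) then g σ else + 0

∑-weaklyIncreasing : ∀ N r (g : List (Fin N) → ℤ) →
  ∑ g (weaklyIncreasing N r) ≡ ∑ (onIncreasing g) (sequences N r)
∑-weaklyIncreasing N r g = ∑-filter (linked? _≤?_) g (sequences N r)

∑-sequences-suc : ∀ N r (h : List (Fin N) → ℤ) →
  ∑ h (sequences N (suc r)) ≡ ∑ (λ i → ∑ (λ σ → h (i ∷ σ)) (sequences N r)) (allFin N)
∑-sequences-suc N r h = trans (∑-concatMap h (λ i → map (i ∷_) (sequences N r)) (allFin N))
  (∑-cong (λ i → ∑-map h (i ∷_) (sequences N r)) (allFin N))

∑-allFin-suc : ∀ n (F : Fin (suc n) → ℤ) → ∑ F (allFin (suc n)) ≡ F fzero ⊕ ∑ (F ∘ fsuc) (allFin n)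
∑-allFin-suc n F =
  cong (F fzero ⊕_) (trans (cong (∑ F) (sym (map-tabulate (λ i → i) fsuc))) (∑-map F fsuc (allFin n)))

onIncreasing-∷ : ∀ {N} (g : List (Fin N) → ℤ) x y σ →
  onIncreasing g (x ∷ y ∷ σ) ≡ (if does (x ≤? y) then onIncreasing (g ∘ (x ∷_)) (y ∷ σ) else + 0)
onIncreasing-∷ g x y σ with does (x ≤? y) | does (linked? _≤?_ (y ∷ σ))
... | true  | true  = refl
... | true  | false = refl
... | false | _     = refl

onIncreasing-0∷ : ∀ {N} (g : List (Fin (suc N)) → ℤ) σ →
  onIncreasing g (fzero ∷ σ) ≡ onIncreasing (g ∘ (fzero ∷_)) σ
onIncreasing-0∷ g []      = refl
onIncreasing-0∷ g (y ∷ σ) = onIncreasing-∷ g fzero y σ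

≤?-suc : ∀ {N} (i j : Fin N) → does (fsuc i ≤? fsuc j) ≡ does (i ≤? j)
≤?-suc i j = <ᵇ-suc (toℕ i) (toℕ j)
  where
  <ᵇ-suc : ∀ a b → (a ℕ.<ᵇ suc b) ≡ (a ℕ.≤ᵇ b)
  <ᵇ-suc zero    b = refl
  <ᵇ-suc (suc a) b = refl

-- A weakly increasing word beginning with a letter i + 1 never uses the letter 0, so it is
-- the image under the shift i ↦ i + 1 of a weakly increasing word over one letter less.
onIncreasing-shift : ∀ {N} r (g : List (Fin (suc N)) → ℤ) (i : Fin N) →
  ∑ (λ σ → onIncreasing g (fsuc i ∷ σ)) (sequences (suc N) r) ≡
  ∑ (λ τ → onIncreasing (g ∘ map fsuc) (i ∷ τ)) (sequences N r)
onIncreasing-shift         zero    g i = refl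
onIncreasing-shift {N} (suc r) g i = begin
  ∑ (λ σ → onIncreasing g (fsuc i ∷ σ)) (sequences (suc N) (suc r))
    ≡⟨ ∑-sequences-suc (suc N) r (λ σ → onIncreasing g (fsuc i ∷ σ)) ⟩
  ∑ second (allFin (suc N))                 ≡⟨ ∑-allFin-suc N second ⟩
  second fzero ⊕ ∑ (second ∘ fsuc) (allFin N)
    ≡⟨ cong₂ _⊕_ (∑-zero _ (λ σ → onIncreasing-∷ g (fsuc i) fzero σ) S) (∑-cong next-letter (allFin N)) ⟩
  + 0 ⊕ ∑ second′ (allFin N)                ≡⟨ ℤP.+-identityˡ _ ⟩
  ∑ second′ (allFin N)                      ≡⟨ ∑-sequences-suc N r (λ τ → onIncreasing (g ∘ map fsuc) (i ∷ τ)) ⟨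
  ∑ (λ τ → onIncreasing (g ∘ map fsuc) (i ∷ τ)) (sequences N (suc r)) ∎
  where
  open ≡-Reasoning
  S : List (List (Fin (suc N)))
  S = sequences (suc N) r
  second : Fin (suc N) → ℤ
  second j = ∑ (λ σ → onIncreasing g (fsuc i ∷ j ∷ σ)) S
  second′ : Fin N → ℤ
  second′ j = ∑ (λ τ → onIncreasing (g ∘ map fsuc) (i ∷ j ∷ τ)) (sequences N r)
  -- a second letter j + 1 is allowed iff i ≤ j; the rest of the word is handled by induction
  next-letter : ∀ j → second (fsuc j) ≡ second′ j
  next-letter j = begin
    second (fsuc j)
      ≡⟨ ∑-cong (λ σ → trans (onIncreasing-∷ g (fsuc i) (fsuc j) σ)
                             (cong (λ b → if b then h (fsuc j ∷ σ) else + 0) (≤?-suc i j))) S ⟩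
    ∑ (λ σ → if i≤j then h (fsuc j ∷ σ) else + 0) S
      ≡⟨ ∑-if i≤j (λ σ → h (fsuc j ∷ σ)) S ⟩
    (if i≤j then ∑ (λ σ → h (fsuc j ∷ σ)) S else + 0)
      ≡⟨ cong (λ x → if i≤j then x else + 0) (onIncreasing-shift r (g ∘ (fsuc i ∷_)) j) ⟩
    (if i≤j then ∑ (λ τ → h′ (j ∷ τ)) (sequences N r) else + 0)
      ≡⟨ ∑-if i≤j (λ τ → h′ (j ∷ τ)) (sequences N r) ⟨
    ∑ (λ τ → if i≤j then h′ (j ∷ τ) else + 0) (sequences N r)
      ≡⟨ ∑-cong (λ τ → onIncreasing-∷ (g ∘ map fsuc) i j τ) (sequences N r) ⟨
    second′ j ∎
    where
    i≤j : Bool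
    i≤j = does (i ≤? j)
    h : List (Fin (suc N)) → ℤ
    h = onIncreasing (g ∘ (fsuc i ∷_))
    h′ : List (Fin N) → ℤ
    h′ = onIncreasing (g ∘ map fsuc ∘ (i ∷_))

-- A weakly increasing word over {0,…,N} of length r + 1 either starts with 0, followed by any
-- weakly increasing word of length r, or avoids 0 and is a shifted word over {0,…,N-1}.
∑-weaklyIncreasing-suc : ∀ N r (g : List (Fin (suc N)) → ℤ) →
  ∑ g (weaklyIncreasing (suc N) (suc r)) ≡
  ∑ (g ∘ (fzero ∷_)) (weaklyIncreasing (suc N) r) ⊕ ∑ (g ∘ map fsuc) (weaklyIncreasing N (suc r))
∑-weaklyIncreasing-suc N r g = begin
  ∑ g (weaklyIncreasing (suc N) (suc r))
    ≡⟨ ∑-weaklyIncreasing (suc N) (suc r) g ⟩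
  ∑ (onIncreasing g) (sequences (suc N) (suc r))
    ≡⟨ ∑-sequences-suc (suc N) r (onIncreasing g) ⟩
  ∑ first (allFin (suc N))
    ≡⟨ ∑-allFin-suc N first ⟩
  first fzero ⊕ ∑ (first ∘ fsuc) (allFin N)
    ≡⟨ cong₂ _⊕_ (∑-cong (onIncreasing-0∷ g) S) (∑-cong (onIncreasing-shift r g) (allFin N)) ⟩
  ∑ (onIncreasing (g ∘ (fzero ∷_))) S ⊕ ∑ (λ i → ∑ (λ τ → shifted (i ∷ τ)) (sequences N r)) (allFin N)
    ≡⟨ cong (∑ (onIncreasing (g ∘ (fzero ∷_))) S ⊕_) (∑-sequences-suc N r shifted) ⟨
  ∑ (onIncreasing (g ∘ (fzero ∷_))) S ⊕ ∑ shifted (sequences N (suc r))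
    ≡⟨ cong₂ _⊕_ (∑-weaklyIncreasing (suc N) r (g ∘ (fzero ∷_)))
                 (∑-weaklyIncreasing N (suc r) (g ∘ map fsuc)) ⟨
  ∑ (g ∘ (fzero ∷_)) (weaklyIncreasing (suc N) r) ⊕ ∑ (g ∘ map fsuc) (weaklyIncreasing N (suc r)) ∎
  where
  open ≡-Reasoning
  S : List (List (Fin (suc N)))
  S = sequences (suc N) r
  first : Fin (suc N) → ℤ
  first i = ∑ (λ σ → onIncreasing g (i ∷ σ)) S
  shifted : List (Fin N) → ℤ
  shifted = onIncreasing (g ∘ map fsuc)

δ : ∀ {N} → Monomial N → Monomial N → ℤ
δ μ ν = if does (ν ≟ₘ μ) then + 1 else + 0

F0-as-sum : ∀ N r (μ : Monomial N) → F0 N r μ ≡ ∑ (δ μ ∘ monomialOf) (weaklyIncreasing N r)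
F0-as-sum N r μ = ∑-map (δ μ) monomialOf (weaklyIncreasing N r)

·ₘ-identityˡ : ∀ {N} (ν : Monomial N) → oneₘ ·ₘ ν ≡ ν
·ₘ-identityˡ []      = refl
·ₘ-identityˡ (e ∷ ν) = cong (e ∷_) (·ₘ-identityˡ ν)

monomialOf-shift : ∀ {N} (τ : List (Fin N)) → monomialOf (map fsuc τ) ≡ nothing ∷ monomialOf τ
monomialOf-shift []      = refl
monomialOf-shift (i ∷ τ) = cong (x⁰ (fsuc i) ·ₘ_) (monomialOf-shift τ)

whenAbsent : Maybe ℕ → ℤ → ℤ
whenAbsent e c = if is-nothing e then c else + 0

x⁰-preimage : Maybe ℕ → List (Maybe ℕ)
x⁰-preimage nothing        = []
x⁰-preimage (just zero)    = nothing ∷ just zero ∷ []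
x⁰-preimage (just (suc a)) = just (suc a) ∷ []

δ-x⁰ : ∀ {N} e (μ : Monomial N) ν →
  δ (e ∷ μ) (x⁰ fzero ·ₘ ν) ≡ ∑ (λ e′ → δ (e′ ∷ μ) ν) (x⁰-preimage e)
δ-x⁰ e μ (e′ ∷ ρ) rewrite ·ₘ-identityˡ ρ with does (ρ ≟ₘ μ)
δ-x⁰ nothing              μ (nothing ∷ ρ)         | d     = refl
δ-x⁰ nothing              μ (just b ∷ ρ)          | d     = refl
δ-x⁰ (just zero)          μ (nothing ∷ ρ)         | true  = refl
δ-x⁰ (just zero)          μ (nothing ∷ ρ)         | false = refl
δ-x⁰ (just zero)          μ (just zero ∷ ρ)       | true  = refl
δ-x⁰ (just zero)          μ (just zero ∷ ρ)       | false = refl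
δ-x⁰ (just zero)          μ (just (suc b) ∷ ρ)    | d     = refl
δ-x⁰ (just (suc a))       μ (nothing ∷ ρ)         | d     = refl
δ-x⁰ (just (suc a))       μ (just zero ∷ ρ)       | d     = refl
δ-x⁰ (just (suc a))       μ (just (suc b) ∷ ρ)    | d     = sym (ℤP.+-identityʳ _)

δ-absent : ∀ {N} e (μ ν : Monomial N) → δ (e ∷ μ) (nothing ∷ ν) ≡ whenAbsent e (δ μ ν)
δ-absent nothing  μ ν = refl
δ-absent (just _) μ ν = refl

-- Coefficientwise form of
--   F_{0^{r+1}}(x_1,…,x_{N+1}) = x_1^0 F_{0^r}(x_1,…,x_{N+1}) + F_{0^{r+1}}(x_2,…,x_{N+1}),
-- i.e. of splitting the weakly increasing words according to whether they start with letter 0.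
F0-rec : ∀ N r e (μ : Monomial N) →
  F0 (suc N) (suc r) (e ∷ μ) ≡
  ∑ (λ e′ → F0 (suc N) r (e′ ∷ μ)) (x⁰-preimage e) ⊕ whenAbsent e (F0 N (suc r) μ)
F0-rec N r e μ = begin
  F0 (suc N) (suc r) (e ∷ μ)
    ≡⟨ F0-as-sum (suc N) (suc r) (e ∷ μ) ⟩
  ∑ (δ (e ∷ μ) ∘ monomialOf) (weaklyIncreasing (suc N) (suc r))
    ≡⟨ ∑-weaklyIncreasing-suc N r (δ (e ∷ μ) ∘ monomialOf) ⟩
  ∑ (λ σ → δ (e ∷ μ) (x⁰ fzero ·ₘ monomialOf σ)) W ⊕ ∑ (λ τ → δ (e ∷ μ) (monomialOf (map fsuc τ))) W′
    ≡⟨ cong₂ _⊕_ (∑-cong (λ σ → δ-x⁰ e μ (monomialOf σ)) W)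
                 (∑-cong (λ τ → trans (cong (δ (e ∷ μ)) (monomialOf-shift τ))
                                      (δ-absent e μ (monomialOf τ))) W′) ⟩
  ∑ (λ σ → ∑ (λ e′ → δ (e′ ∷ μ) (monomialOf σ)) (x⁰-preimage e)) W
    ⊕ ∑ (λ τ → whenAbsent e (δ μ (monomialOf τ))) W′
    ≡⟨ cong₂ _⊕_ (∑-comm (λ σ e′ → δ (e′ ∷ μ) (monomialOf σ)) W (x⁰-preimage e))
                 (∑-if (is-nothing e) (δ μ ∘ monomialOf) W′) ⟩
  ∑ (λ e′ → ∑ (δ (e′ ∷ μ) ∘ monomialOf) W) (x⁰-preimage e) ⊕ whenAbsent e (∑ (δ μ ∘ monomialOf) W′)
    ≡⟨ cong₂ _⊕_ (∑-cong (λ e′ → F0-as-sum (suc N) r (e′ ∷ μ)) (x⁰-preimage e))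
                 (cong (whenAbsent e) (F0-as-sum N (suc r) μ)) ⟨
  ∑ (λ e′ → F0 (suc N) r (e′ ∷ μ)) (x⁰-preimage e) ⊕ whenAbsent e (F0 N (suc r) μ) ∎
  where
  open ≡-Reasoning
  W : List (List (Fin (suc N)))
  W = weaklyIncreasing (suc N) r
  W′ : List (List (Fin N))
  W′ = weaklyIncreasing N (suc r)

-- An absent first variable
-- changes nothing; a factor x_1^0 comes from the words starting with k ≥ 1 copies of the first
-- letter, so its coefficient is Σ_{s<r} (coefficient of the rest in F_{0^s}); positive
-- exponents never occur.
F0coeff : ∀ {N} → ℕ → Monomial N → ℤ
F0coeff r []                 = isZero r
F0coeff r (nothing ∷ μ)      = F0coeff r μ
F0coeff r (just zero ∷ μ)    = ∑< r (λ s → F0coeff s μ)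
F0coeff r (just (suc _) ∷ μ) = + 0

F0coeff-rec : ∀ {N} r e (μ : Monomial N) →
  F0coeff (suc r) (e ∷ μ) ≡
  ∑ (λ e′ → F0coeff r (e′ ∷ μ)) (x⁰-preimage e) ⊕ whenAbsent e (F0coeff (suc r) μ)
F0coeff-rec r nothing        μ = sym (ℤP.+-identityˡ _)
F0coeff-rec r (just zero)    μ =
  trans (∑<-last r (λ s → F0coeff s μ)) (regroup (∑< r (λ s → F0coeff s μ)) (F0coeff r μ))
  where
  regroup : ∀ a b → a ⊕ b ≡ b ⊕ (a ⊕ + 0) ⊕ + 0
  regroup = solve-∀
F0coeff-rec r (just (suc a)) μ = refl

F0≡F0coeff : ∀ r {N} (μ : Monomial N) → F0 N r μ ≡ F0coeff r μ
F0≡F0coeff zero    []                 = refl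
F0≡F0coeff zero    (nothing ∷ μ)      = F0≡F0coeff zero μ
F0≡F0coeff zero    (just zero ∷ μ)    = refl
F0≡F0coeff zero    (just (suc _) ∷ μ) = refl
F0≡F0coeff (suc r) []                 = refl
F0≡F0coeff (suc r) {suc N} (e ∷ μ)    = begin
  F0 (suc N) (suc r) (e ∷ μ)
    ≡⟨ F0-rec N r e μ ⟩
  ∑ (λ e′ → F0 (suc N) r (e′ ∷ μ)) (x⁰-preimage e) ⊕ whenAbsent e (F0 N (suc r) μ)
    ≡⟨ cong₂ _⊕_ (∑-cong (λ e′ → F0≡F0coeff r (e′ ∷ μ)) (x⁰-preimage e))
                 (cong (whenAbsent e) (F0≡F0coeff (suc r) μ)) ⟩
  ∑ (λ e′ → F0coeff r (e′ ∷ μ)) (x⁰-preimage e) ⊕ whenAbsent e (F0coeff (suc r) μ)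
    ≡⟨ F0coeff-rec r e μ ⟨
  F0coeff (suc r) (e ∷ μ) ∎
  where open ≡-Reasoning

prodCoeff : ∀ {N} → ℕ → ℕ → Monomial N → ℤ
prodCoeff m n μ = ∑ (λ p → F0coeff m (proj₁ p) * F0coeff n (proj₂ p)) (factorsₘ μ)

∑-factorsₘ-∷ : ∀ {N} (h : Monomial (suc N) × Monomial (suc N) → ℤ) e (μ : Monomial N) →
  ∑ h (factorsₘ (e ∷ μ)) ≡
  ∑ (λ ee → ∑ (λ mm → h (proj₁ ee ∷ proj₁ mm , proj₂ ee ∷ proj₂ mm)) (factorsₘ μ)) (factorsₑ e)
∑-factorsₘ-∷ h e μ = trans (∑-map h _ (cartesianProduct (factorsₑ e) (factorsₘ μ)))
                           (∑-cartesianProduct _ (factorsₑ e) (factorsₘ μ))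

-- A variable with positive exponent occurs in no F_{0^r}, so in none of the factors.
prodCoeff-positive : ∀ {N} m n a (μ : Monomial N) → prodCoeff m n (just (suc a) ∷ μ) ≡ + 0
prodCoeff-positive m n a μ =
  trans (∑-factorsₘ-∷ (λ p → F0coeff m (proj₁ p) * F0coeff n (proj₂ p)) (just (suc a)) μ)
        (cong₂ _⊕_ (∑-zero _ (λ p → ℤP.*-zeroʳ (F0coeff m (nothing ∷ proj₁ p))) (factorsₘ μ))
        (cong₂ _⊕_ (∑-zero _ (λ _ → refl) (factorsₘ μ))
                   (trans (∑-map inner (λ b → just b , just (suc a ∸ b)) (upTo (suc (suc a))))
                          (∑-zero _ splitExponent (upTo (suc (suc a)))))))
  where
  inner : Maybe ℕ × Maybe ℕ → ℤ
  inner ee =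
    ∑ (λ mm → F0coeff m (proj₁ ee ∷ proj₁ mm) * F0coeff n (proj₂ ee ∷ proj₂ mm)) (factorsₘ μ)

  -- x^{a+1} = x^b x^{a+1-b}: one of the two exponents is positive
  splitExponent : ∀ b → inner (just b , just (suc a ∸ b)) ≡ + 0
  splitExponent zero    =
    ∑-zero _ (λ mm → ℤP.*-zeroʳ (F0coeff m (just zero ∷ proj₁ mm))) (factorsₘ μ)
  splitExponent (suc b) = ∑-zero _ (λ _ → refl) (factorsₘ μ)

-- A variable with exponent 0 in the product: for each factorisation (μ₁ , μ₂) of μ the
-- factor pairs (x^∅,x^0), (x^0,x^∅), (x^0,x^0) contribute a·B + A·b + A·B = (A + a)(B + b) − a·b,
-- where a, b are the coefficients of μ₁, μ₂ and A, B their partial sums (Σ_{s<m}, Σ_{t<n}).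
prodCoeff-x⁰ : ∀ {N} m n (μ : Monomial N) →
  prodCoeff m n (just zero ∷ μ) ⊕ prodCoeff m n μ ≡ ∑≤² (λ s t → prodCoeff s t μ) m n
prodCoeff-x⁰ {N} m n μ = begin
  prodCoeff m n (just zero ∷ μ) ⊕ ∑ ab P
    ≡⟨ cong (_⊕ ∑ ab P) (∑-factorsₘ-∷ (λ p → F0coeff m (proj₁ p) * F0coeff n (proj₂ p)) (just zero) μ) ⟩
  ∑ aB P ⊕ (∑ Ab P ⊕ (∑ AB P ⊕ + 0)) ⊕ ∑ ab P
    ≡⟨ cong (λ x → ∑ aB P ⊕ (∑ Ab P ⊕ x) ⊕ ∑ ab P) (ℤP.+-identityʳ (∑ AB P)) ⟩
  ∑ aB P ⊕ (∑ Ab P ⊕ ∑ AB P) ⊕ ∑ ab P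
    ≡⟨ collect ⟨
  ∑ (λ p → aB p ⊕ (Ab p ⊕ AB p) ⊕ ab p) P
    ≡⟨ ∑-cong (λ p → expand (a p) (A p) (b p) (B p)) P ⟩
  ∑ (λ p → (A p ⊕ a p) * (B p ⊕ b p)) P
    ≡⟨ ∑-cong (λ p → cong₂ _*_ (∑<-last m (λ s → F0coeff s (proj₁ p)))
                               (∑<-last n (λ t → F0coeff t (proj₂ p)))) P ⟨
  ∑ (λ p → ∑< (suc m) (λ s → F0coeff s (proj₁ p)) * ∑< (suc n) (λ t → F0coeff t (proj₂ p))) P
    ≡⟨ ∑-bilinear (λ s p → F0coeff s (proj₁ p)) (λ t p → F0coeff t (proj₂ p)) (suc m) (suc n) P ⟩
  ∑≤² (λ s t → prodCoeff s t μ) m n ∎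
  where
  open ≡-Reasoning
  P : List (Monomial N × Monomial N)
  P = factorsₘ μ
  a A b B aB Ab AB ab : Monomial N × Monomial N → ℤ
  a p = F0coeff m (proj₁ p)
  A p = F0coeff m (just zero ∷ proj₁ p)
  b p = F0coeff n (proj₂ p)
  B p = F0coeff n (just zero ∷ proj₂ p)
  aB p = a p * B p
  Ab p = A p * b p
  AB p = A p * B p
  ab p = a p * b p
  collect : ∑ (λ p → aB p ⊕ (Ab p ⊕ AB p) ⊕ ab p) P ≡ ∑ aB P ⊕ (∑ Ab P ⊕ ∑ AB P) ⊕ ∑ ab P
  collect = trans (∑-+ (λ p → aB p ⊕ (Ab p ⊕ AB p)) ab P)
                  (cong (_⊕ ∑ ab P) (trans (∑-+ aB (λ p → Ab p ⊕ AB p) P)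
                                           (cong (∑ aB P ⊕_) (∑-+ Ab AB P))))
  expand : ∀ a A b B → a * B ⊕ (A * b ⊕ A * B) ⊕ a * b ≡ (A ⊕ a) * (B ⊕ b)
  expand = solve-∀

-- The only
-- nontrivial step is a variable with exponent 0, where prodCoeff-x⁰ (on the left) and
-- RHS-strictPartialSums (on the right) produce the same recursion.
prodCoeff≡RHS : ∀ {N} (μ : Monomial N) m n → prodCoeff m n μ ≡ RHS (λ r → F0coeff r μ) m n
prodCoeff≡RHS []                 m n = trans (ℤP.+-identityʳ _) (sym (RHS-isZero m n))
prodCoeff≡RHS (nothing ∷ μ)      m n =
  trans (∑-factorsₘ-∷ (λ p → F0coeff m (proj₁ p) * F0coeff n (proj₂ p)) nothing μ)
        (trans (ℤP.+-identityʳ _) (prodCoeff≡RHS μ m n))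
prodCoeff≡RHS (just (suc a) ∷ μ) m n = trans (prodCoeff-positive m n a μ) (sym (RHS-zero m n))
prodCoeff≡RHS (just zero ∷ μ)    m n = begin
  prodCoeff m n (just zero ∷ μ)
    ≡⟨ cancel (prodCoeff m n (just zero ∷ μ)) (prodCoeff m n μ) ⟩
  prodCoeff m n (just zero ∷ μ) ⊕ prodCoeff m n μ ⊕ - prodCoeff m n μ
    ≡⟨ cong₂ (λ x y → x ⊕ - y) (prodCoeff-x⁰ m n μ) (prodCoeff≡RHS μ m n) ⟩
  ∑≤² (λ s t → prodCoeff s t μ) m n ⊕ - RHS v m n
    ≡⟨ cong (_⊕ - RHS v m n) (∑≤²-cong (prodCoeff≡RHS μ) m n) ⟩
  ∑≤² (RHS v) m n ⊕ - RHS v m n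
    ≡⟨ RHS-strictPartialSums v m n ⟨
  RHS (λ r → ∑< r v) m n ∎
  where
  open ≡-Reasoning
  v : ℕ → ℤ
  v r = F0coeff r μ
  cancel : ∀ x y → x ≡ x ⊕ y ⊕ - y
  cancel = solve-∀

foldr-+ₛ-apply : ∀ {N} (s : ℕ → Series N) (μ : Monomial N) js →
  foldr (λ j acc → s j +ₛ acc) 0ₛ js μ ≡ ∑ (λ j → s j μ) js
foldr-+ₛ-apply s μ []       = refl
foldr-+ₛ-apply s μ (j ∷ js) = cong (s j μ ⊕_) (foldr-+ₛ-apply s μ js)

lemma3p2 : (m n : ℕ) → 1 ≤ m → 1 ≤ n → (N : ℕ) →
    (F0 N m *ₛ F0 N n) ≈ₛ
      (Σₛ[j≤ m ] (λ j → (sign j * (+ (m C j) * + ((m + n ∸ j) C m))) •ₛ F0 N (m + n ∸ j)))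
lemma3p2 m n _ _ N μ = begin
  (F0 N m *ₛ F0 N n) μ
    ≡⟨ ∑-cong (λ p → cong₂ _*_ (F0≡F0coeff m (proj₁ p)) (F0≡F0coeff n (proj₂ p))) (factorsₘ μ) ⟩
  prodCoeff m n μ
    ≡⟨ prodCoeff≡RHS μ m n ⟩
  RHS (λ r → F0coeff r μ) m n
    ≡⟨ ∑-cong (λ j → cong (coeff m n j *_) (F0≡F0coeff (m + n ∸ j) μ)) (upTo (suc m)) ⟨
  ∑< (suc m) (λ j → coeff m n j * F0 N (m + n ∸ j) μ)
    ≡⟨ foldr-+ₛ-apply (λ j → coeff m n j •ₛ F0 N (m + n ∸ j)) μ (upTo (suc m)) ⟨
  (Σₛ[j≤ m ] (λ j → coeff m n j •ₛ F0 N (m + n ∸ j))) μ ∎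
  where open ≡-Reasoning
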